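{- For all integers $p>0$ and $n\ge0$, \[ J_{n+1}=\sum_{r=0}^{p-1}D^{(r)}_n+\sum_{k=p}^{n}\binom{k-1}{p-1}J_{n+1-k}. \]
   Context: Jacobsthal numbers: $J_0=0$, $J_1=1$, $J_k=J_{k-1}+2J_{k-2}$ for $k\ge2$. For integers $n,r\ge0$, $D^{(r)}_n$ is the number of $n$-tilings containing exactly $r$ squares, where an $n$-tiling is a tiling of a board (a $1\times L$ row of unit cells, any $L\ge0$) using exactly $n$ tiles, each a square ($1\times1$ tile) or a $(1,1)$-fence (two $1\times1$ posts separated by a one-cell gap, placed on cells $i$ and $i+2$ with the gap cell covered by another tile), each cell covered exactly once. The empty tiling counts, so $D^{(0)}_0=1$; for $n>0$, $D^{(0)}_n$ is $1$ if $n$ is even and $0$ if $n$ is odd. An empty sum is $0$. -}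

module Defs where

open import Data.Nat using (ℕ; zero; suc; _+_; _*_; _∸_; _≡ᵇ_; _<ᵇ_)
open import Data.Nat.Combinatorics using (_C_)
open import Data.Bool using (Bool; true; false; _∧_; _∨_; not)
open import Data.List using (List; []; _∷_; length; map; concatMap; filterᵇ; upTo; foldr)
open import Data.Nat.ListAction using (sum)
open import Data.Maybe using (Maybe; just; nothing)

J : ℕ → ℕ
J zero = 0
J (suc zero) = 1
J (suc (suc k)) = J (suc k) + 2 * J k

-- A tiling of a board of length L is encoded by labelling each cell with
-- the part of the tile covering it: a square, the left post of a
-- (1,1)-fence, or the right post of a (1,1)-fence.
data Cell : Set where
  sq lpost rpost : Cell

isSq isL isR : Cell → Bool
isSq sq = true
isSq _  = false
isL lpost = true
isL _     = false
isR rpost = true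
isR _     = false

at : List Cell → ℕ → Maybe Cell
at []       _       = nothing
at (c ∷ cs) zero    = just c
at (c ∷ cs) (suc i) = at cs i

atIs : (Cell → Bool) → List Cell → ℕ → Bool
atIs f cs i with at cs i
... | just c  = f c
... | nothing = false

_⇔ᵇ_ : Bool → Bool → Bool
a ⇔ᵇ b = (a ∧ b) ∨ (not a ∧ not b)

-- Hence the posts pair up into fences occupying cells i and i+2.
validCellᵇ : List Cell → ℕ → Bool
validCellᵇ cs i =
  (atIs isL cs i ⇔ᵇ atIs isR cs (i + 2)) ∧
  (atIs isR cs i ⇔ᵇ ((1 <ᵇ i) ∧ atIs isL cs (i ∸ 2)))

allᵇ : List Bool → Bool
allᵇ = foldr _∧_ true

validᵇ : List Cell → Bool
validᵇ cs = allᵇ (map (validCellᵇ cs) (upTo (length cs)))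

count : (Cell → Bool) → List Cell → ℕ
count f cs = length (filterᵇ f cs)

squares tiles : List Cell → ℕ
squares cs = count isSq cs
tiles cs = count isSq cs + count isL cs

boards : ℕ → List (List Cell)
boards zero = [] ∷ []
boards (suc L) = concatMap (λ cs → (sq ∷ cs) ∷ (lpost ∷ cs) ∷ (rpost ∷ cs) ∷ []) (boards L)

tilingsOf : ℕ → ℕ → ℕ → ℕ
tilingsOf L n r =
  length (filterᵇ (λ cs → validᵇ cs ∧ (tiles cs ≡ᵇ n) ∧ (squares cs ≡ᵇ r)) (boards L))

-- D^{(r)}_n : n-tilings with exactly r squares, over all board lengths L.
-- An n-tiling covers at most 2n cells, so L ranges over 0..2n.
D : ℕ → ℕ → ℕ
D n r = sum (map (λ L → tilingsOf L n r) (upTo (suc (2 * n))))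

sumD : ℕ → ℕ → ℕ
sumD p n = sum (map (D n) (upTo p))

sumJ : ℕ → ℕ → ℕ
sumJ p n = sum (map (λ i → let k = p + i in ((k ∸ 1) C (p ∸ 1)) * J (suc n ∸ k)) (upTo (suc n ∸ p)))

-- Reading a tiling from the left, it starts either with a square, or with a
-- fence whose gap holds a square (cells L S R), or with a fence whose gap holds
-- the left post of a second fence (cells L L R R).  Hence the number D′ n r of
-- n-tilings with r squares satisfies
--   D′ (n+2) (r+1) = D′ (n+1) r + D′ n r + D′ n (r+1),
-- and summing over r < p this recurrence shows, together with
-- J (n+3) = J (n+2) + J (n+1) + J (n+1), that the number of n-tilings with at
-- least p squares is the p-fold iterated partial sum of J ∘ suc.  Pascal's rule
-- identifies that iterated sum with the binomial sum of the statement.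
module Submission where

open import Defs
open import Data.Nat using (ℕ; zero; suc; _+_; _*_; _∸_; _≡ᵇ_; _<ᵇ_; _≤_; _<_; _>_; s≤s; z≤n; _≤?_)
open import Data.Nat.Properties
open import Data.Nat.Combinatorics using (_C_; nCk+nC[k+1]≡[n+1]C[k+1]; k>n⇒nCk≡0)
open import Data.Nat.ListAction using (sum)
open import Data.Nat.Tactic.RingSolver using (solve-∀)
open import Data.Bool using (Bool; true; false; _∧_; not; if_then_else_)
open import Data.Bool.Properties using (∧-zeroʳ)
open import Data.List using (List; []; _∷_; length; map; concatMap; filterᵇ; upTo; applyUpTo; foldr; _++_)
open import Data.Maybe using (just; nothing)
open import Data.Product using (_,_)
open import Function using (_∘_; id)
open import Relation.Binary.PropositionalEquality
  using (_≡_; refl; sym; trans; cong; cong₂; subst; module ≡-Reasoning)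
open import Relation.Nullary using (yes; no)
open import Algebra.Properties.CommutativeSemigroup +-commutativeSemigroup using (interchange)

open ≡-Reasoning

foldUpTo : {A : Set} → (A → A → A) → A → ℕ → (ℕ → A) → A
foldUpTo _∙_ e zero    f = e
foldUpTo _∙_ e (suc n) f = f 0 ∙ foldUpTo _∙_ e n (f ∘ suc)

foldr-map-applyUpTo : {A : Set} (_∙_ : A → A → A) (e : A) (g : ℕ → A) (f : ℕ → ℕ) (n : ℕ) →
                      foldr _∙_ e (map g (applyUpTo f n)) ≡ foldUpTo _∙_ e n (g ∘ f)
foldr-map-applyUpTo _∙_ e g f zero    = refl
foldr-map-applyUpTo _∙_ e g f (suc n) = cong (g (f 0) ∙_) (foldr-map-applyUpTo _∙_ e g (f ∘ suc) n)

foldUpTo-cong : {A : Set} (_∙_ : A → A → A) (e : A) (n : ℕ) {f g : ℕ → A} →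
                (∀ i → f i ≡ g i) → foldUpTo _∙_ e n f ≡ foldUpTo _∙_ e n g
foldUpTo-cong _∙_ e zero    f≗g = refl
foldUpTo-cong _∙_ e (suc n) f≗g = cong₂ _∙_ (f≗g 0) (foldUpTo-cong _∙_ e n (f≗g ∘ suc))

∑ : ℕ → (ℕ → ℕ) → ℕ
∑ = foldUpTo _+_ 0

sum-map-upTo : ∀ (f : ℕ → ℕ) n → sum (map f (upTo n)) ≡ ∑ n f
sum-map-upTo f = foldr-map-applyUpTo _+_ 0 f id

∑-cong : ∀ n {f g : ℕ → ℕ} → (∀ i → f i ≡ g i) → ∑ n f ≡ ∑ n g
∑-cong = foldUpTo-cong _+_ 0

∑-zero : ∀ n → ∑ n (λ _ → 0) ≡ 0
∑-zero zero    = refl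
∑-zero (suc n) = ∑-zero n

∑-distrib-+ : ∀ n (f g : ℕ → ℕ) → ∑ n (λ i → f i + g i) ≡ ∑ n f + ∑ n g
∑-distrib-+ zero    f g = refl
∑-distrib-+ (suc n) f g = begin
  (f 0 + g 0) + ∑ n (λ i → f (suc i) + g (suc i))  ≡⟨ cong ((f 0 + g 0) +_) (∑-distrib-+ n (f ∘ suc) (g ∘ suc)) ⟩
  (f 0 + g 0) + (∑ n (f ∘ suc) + ∑ n (g ∘ suc))    ≡⟨ interchange (f 0) (g 0) _ _ ⟩
  (f 0 + ∑ n (f ∘ suc)) + (g 0 + ∑ n (g ∘ suc))    ∎

countWhere : {A : Set} → (A → Bool) → List A → ℕ
countWhere P xs = length (filterᵇ P xs)

module _ {A : Set} where

  countWhere-∷ : ∀ (P : A → Bool) x xs → countWhere P (x ∷ xs) ≡ (if P x then 1 else 0) + countWhere P xs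
  countWhere-∷ P x xs with P x
  ... | true  = refl
  ... | false = refl

  countWhere-cong : ∀ {P Q : A → Bool} → (∀ x → P x ≡ Q x) → ∀ xs → countWhere P xs ≡ countWhere Q xs
  countWhere-cong         P≗Q []       = refl
  countWhere-cong {P} {Q} P≗Q (x ∷ xs) = begin
    countWhere P (x ∷ xs)                          ≡⟨ countWhere-∷ P x xs ⟩
    (if P x then 1 else 0) + countWhere P xs       ≡⟨ cong₂ (λ b k → (if b then 1 else 0) + k) (P≗Q x) (countWhere-cong P≗Q xs) ⟩
    (if Q x then 1 else 0) + countWhere Q xs       ≡⟨ countWhere-∷ Q x xs ⟨
    countWhere Q (x ∷ xs)                          ∎

  countWhere-false : ∀ xs → countWhere (λ (_ : A) → false) xs ≡ 0
  countWhere-false []       = refl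
  countWhere-false (x ∷ xs) = countWhere-false xs

countWhere-boards-suc : ∀ L P →
  countWhere P (boards (suc L)) ≡
    countWhere (P ∘ (sq ∷_)) (boards L) + (countWhere (P ∘ (lpost ∷_)) (boards L) + countWhere (P ∘ (rpost ∷_)) (boards L))
countWhere-boards-suc L P = go (boards L)
  where
  [_] : Bool → ℕ
  [ b ] = if b then 1 else 0

  extend : List Cell → List (List Cell)
  extend cs = (sq ∷ cs) ∷ (lpost ∷ cs) ∷ (rpost ∷ cs) ∷ []

  regroup : ∀ a b c x y z → a + (b + (c + (x + (y + z)))) ≡ (a + x) + ((b + y) + (c + z))
  regroup = solve-∀

  go : ∀ css → countWhere P (concatMap extend css) ≡
               countWhere (P ∘ (sq ∷_)) css + (countWhere (P ∘ (lpost ∷_)) css + countWhere (P ∘ (rpost ∷_)) css)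
  go []         = refl
  go (cs ∷ css) = begin
    countWhere P ((sq ∷ cs) ∷ (lpost ∷ cs) ∷ (rpost ∷ cs) ∷ rest)
      ≡⟨ countWhere-∷ P (sq ∷ cs) _ ⟩
    [ P (sq ∷ cs) ] + countWhere P ((lpost ∷ cs) ∷ (rpost ∷ cs) ∷ rest)
      ≡⟨ cong ([ P (sq ∷ cs) ] +_) (countWhere-∷ P (lpost ∷ cs) _) ⟩
    [ P (sq ∷ cs) ] + ([ P (lpost ∷ cs) ] + countWhere P ((rpost ∷ cs) ∷ rest))
      ≡⟨ cong (λ k → [ P (sq ∷ cs) ] + ([ P (lpost ∷ cs) ] + k)) (countWhere-∷ P (rpost ∷ cs) rest) ⟩
    [ P (sq ∷ cs) ] + ([ P (lpost ∷ cs) ] + ([ P (rpost ∷ cs) ] + countWhere P rest))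
      ≡⟨ cong (λ k → [ P (sq ∷ cs) ] + ([ P (lpost ∷ cs) ] + ([ P (rpost ∷ cs) ] + k))) (go css) ⟩
    [ P (sq ∷ cs) ] + ([ P (lpost ∷ cs) ] + ([ P (rpost ∷ cs) ] + (countWhere Ps css + (countWhere Pl css + countWhere Pr css))))
      ≡⟨ regroup [ P (sq ∷ cs) ] [ P (lpost ∷ cs) ] [ P (rpost ∷ cs) ] (countWhere Ps css) (countWhere Pl css) (countWhere Pr css) ⟩
    ([ Ps cs ] + countWhere Ps css) + (([ Pl cs ] + countWhere Pl css) + ([ Pr cs ] + countWhere Pr css))
      ≡⟨ cong₂ _+_ (countWhere-∷ Ps cs css) (cong₂ _+_ (countWhere-∷ Pl cs css) (countWhere-∷ Pr cs css)) ⟨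
    countWhere Ps (cs ∷ css) + (countWhere Pl (cs ∷ css) + countWhere Pr (cs ∷ css)) ∎
    where
    rest : List (List Cell)
    rest = concatMap extend css
    Ps Pl Pr : List Cell → Bool
    Ps = P ∘ (sq ∷_)
    Pl = P ∘ (lpost ∷_)
    Pr = P ∘ (rpost ∷_)

countBelow : ℕ → (List Cell → Bool) → ℕ
countBelow M P = ∑ M (λ L → countWhere P (boards L))

countBelow-cong : ∀ M {P Q} → (∀ cs → P cs ≡ Q cs) → countBelow M P ≡ countBelow M Q
countBelow-cong M P≗Q = ∑-cong M (λ L → countWhere-cong P≗Q (boards L))

countBelow-false : ∀ M {P} → (∀ cs → P cs ≡ false) → countBelow M P ≡ 0
countBelow-false M P≗false = begin
  countBelow M _              ≡⟨ countBelow-cong M P≗false ⟩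
  countBelow M (λ _ → false)  ≡⟨ ∑-cong M (λ L → countWhere-false (boards L)) ⟩
  ∑ M (λ _ → 0)               ≡⟨ ∑-zero M ⟩
  0                           ∎

countBelow-suc : ∀ M P →
  countBelow (suc M) P ≡
    (if P [] then 1 else 0) + (countBelow M (P ∘ (sq ∷_)) + (countBelow M (P ∘ (lpost ∷_)) + countBelow M (P ∘ (rpost ∷_))))
countBelow-suc M P = cong₂ _+_ (trans (countWhere-∷ P [] []) (+-identityʳ _)) (begin
  ∑ M (λ L → countWhere P (boards (suc L)))
    ≡⟨ ∑-cong M (λ L → countWhere-boards-suc L P) ⟩
  ∑ M (λ L → cw (P ∘ (sq ∷_)) L + (cw (P ∘ (lpost ∷_)) L + cw (P ∘ (rpost ∷_)) L))
    ≡⟨ ∑-distrib-+ M (cw (P ∘ (sq ∷_))) _ ⟩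
  countBelow M (P ∘ (sq ∷_)) + ∑ M (λ L → cw (P ∘ (lpost ∷_)) L + cw (P ∘ (rpost ∷_)) L)
    ≡⟨ cong (countBelow M (P ∘ (sq ∷_)) +_) (∑-distrib-+ M (cw (P ∘ (lpost ∷_))) (cw (P ∘ (rpost ∷_)))) ⟩
  countBelow M (P ∘ (sq ∷_)) + (countBelow M (P ∘ (lpost ∷_)) + countBelow M (P ∘ (rpost ∷_))) ∎)
  where
  cw : (List Cell → Bool) → ℕ → ℕ
  cw Q L = countWhere Q (boards L)

countBelow-rpost : ∀ M P → P [] ≡ false → (∀ cs → P (sq ∷ cs) ≡ false) → (∀ cs → P (lpost ∷ cs) ≡ false) →
                   countBelow M P ≡ countBelow (M ∸ 1) (P ∘ (rpost ∷_))
countBelow-rpost zero    P P[] Psq Plpost = refl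
countBelow-rpost (suc M) P P[] Psq Plpost = begin
  countBelow (suc M) P
    ≡⟨ countBelow-suc M P ⟩
  (if P [] then 1 else 0) + (countBelow M (P ∘ (sq ∷_)) + (countBelow M (P ∘ (lpost ∷_)) + countBelow M (P ∘ (rpost ∷_))))
    ≡⟨ cong₂ (λ b k → (if b then 1 else 0) + k) P[] (cong₂ _+_ (countBelow-false M Psq) (cong (_+ countBelow M (P ∘ (rpost ∷_))) (countBelow-false M Plpost))) ⟩
  countBelow M (P ∘ (rpost ∷_)) ∎

-- The flags say whether the cells two places and one place before the current
-- one are left posts.
validFrom : Bool → Bool → List Cell → Bool
validFrom a b []       = true
validFrom a b (c ∷ cs) = ((isL c ⇔ᵇ atIs isR cs 1) ∧ (isR c ⇔ᵇ a)) ∧ validFrom b (isL c) cs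

atIs-cong : ∀ f xs i ys j → at xs i ≡ at ys j → atIs f xs i ≡ atIs f ys j
atIs-cong f xs i ys j eq with at xs i | at ys j
atIs-cong f xs i ys j refl | just c  | just .c = refl
atIs-cong f xs i ys j refl | nothing | nothing = refl

leftPostTwoBefore : List Cell → ℕ → Bool
leftPostTwoBefore xs j = (1 <ᵇ j) ∧ atIs isL xs (j ∸ 2)

validCells-suffix : ∀ xs j ys → (∀ i → at xs (j + i) ≡ at ys i) →
                    foldUpTo _∧_ true (length ys) (λ i → validCellᵇ xs (j + i)) ≡
                    validFrom (leftPostTwoBefore xs j) (leftPostTwoBefore xs (suc j)) ys
validCells-suffix xs j []       suffix = refl
validCells-suffix xs j (c ∷ cs) suffix = cong₂ _∧_ head (begin
  foldUpTo _∧_ true (length cs) (λ i → validCellᵇ xs (j + suc i))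
    ≡⟨ foldUpTo-cong _∧_ true (length cs) (λ i → cong (validCellᵇ xs) (+-suc j i)) ⟩
  foldUpTo _∧_ true (length cs) (λ i → validCellᵇ xs (suc j + i))
    ≡⟨ validCells-suffix xs (suc j) cs (λ i → trans (cong (at xs) (sym (+-suc j i))) (suffix (suc i))) ⟩
  validFrom (leftPostTwoBefore xs (suc j)) (atIs isL xs j) cs
    ≡⟨ cong (λ b → validFrom (leftPostTwoBefore xs (suc j)) b cs) (atj isL) ⟩
  validFrom (leftPostTwoBefore xs (suc j)) (isL c) cs ∎)
  where
  atj : ∀ f → atIs f xs j ≡ f c
  atj f = atIs-cong f xs j (c ∷ cs) 0 (trans (cong (at xs) (sym (+-identityʳ j))) (suffix 0))

  head : validCellᵇ xs (j + 0) ≡ ((isL c ⇔ᵇ atIs isR cs 1) ∧ (isR c ⇔ᵇ leftPostTwoBefore xs j))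
  head rewrite +-identityʳ j | atj isL | atj isR
             | atIs-cong isR xs (j + 2) (c ∷ cs) 2 (suffix 2) = refl

validᵇ≡validFrom : ∀ cs → validᵇ cs ≡ validFrom false false cs
validᵇ≡validFrom cs = trans (foldr-map-applyUpTo _∧_ true (validCellᵇ cs) id (length cs))
                            (validCells-suffix cs 0 cs (λ i → refl))

validFrom-rpost : ∀ b cs → validFrom false b (rpost ∷ cs) ≡ false
validFrom-rpost b cs = cong (_∧ validFrom b false cs) (∧-zeroʳ (isL rpost ⇔ᵇ atIs isR cs 1))

-- The next two lemmas are stated in the shape in which these conditions arise
-- when validFrom unfolds over a prefix.
validFrom-noRpostAt0 : ∀ cs → (not (atIs isR cs 0) ∧ true) ∧ validFrom false false cs ≡ validFrom false false cs
validFrom-noRpostAt0 []           = refl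
validFrom-noRpostAt0 (sq ∷ cs)    = refl
validFrom-noRpostAt0 (lpost ∷ cs) = refl
validFrom-noRpostAt0 (rpost ∷ cs) = sym (validFrom-rpost false cs)

validFrom-noRpostAt1 : ∀ cs → (not (atIs isR cs 1) ∧ true) ∧ validFrom false false cs ≡ validFrom false false cs
validFrom-noRpostAt1 []               = refl
validFrom-noRpostAt1 (c ∷ [])         = refl
validFrom-noRpostAt1 (c ∷ sq ∷ cs)    = refl
validFrom-noRpostAt1 (c ∷ lpost ∷ cs) = refl
validFrom-noRpostAt1 (c ∷ rpost ∷ cs) =
  sym (trans (cong (firstCell ∧_) (validFrom-rpost (isL c) cs)) (∧-zeroʳ firstCell))
  where
  firstCell : Bool
  firstCell = (isL c ⇔ᵇ atIs isR (rpost ∷ cs) 1) ∧ (isR c ⇔ᵇ false)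

validFrom-sq : ∀ cs → validFrom false false (sq ∷ cs) ≡ validFrom false false cs
validFrom-sq = validFrom-noRpostAt1

validFrom-fenceSq : ∀ cs → validFrom false false (lpost ∷ sq ∷ rpost ∷ cs) ≡ validFrom false false cs
validFrom-fenceSq cs = trans (cong ((not (atIs isR cs 0) ∧ true) ∧_) (validFrom-noRpostAt1 cs)) (validFrom-noRpostAt0 cs)

-- Both prefixes unfold to the same condition on cs.
validFrom-twoFences : ∀ cs → validFrom false false (lpost ∷ lpost ∷ rpost ∷ rpost ∷ cs) ≡ validFrom false false cs
validFrom-twoFences = validFrom-fenceSq

tiles-lpost : ∀ cs → tiles (lpost ∷ cs) ≡ suc (tiles cs)
tiles-lpost cs = +-suc (count isSq cs) (count isL cs)

hasCounts : ℕ → ℕ → List Cell → Bool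
hasCounts n r cs = (tiles cs ≡ᵇ n) ∧ (squares cs ≡ᵇ r)

-- afterTiles t s n r accepts what remains once t tiles, s of them squares,
-- have been read; it rejects when t > n or s > r.
mutual
  tilingᵇ : ℕ → ℕ → List Cell → Bool
  tilingᵇ n r []                                       = (0 ≡ᵇ n) ∧ (0 ≡ᵇ r)
  tilingᵇ n r (sq ∷ cs)                                = afterTiles 1 1 n r cs
  tilingᵇ n r (lpost ∷ sq ∷ rpost ∷ cs)                = afterTiles 2 1 n r cs
  tilingᵇ n r (lpost ∷ lpost ∷ rpost ∷ rpost ∷ cs)     = afterTiles 2 0 n r cs
  tilingᵇ n r _                                        = false

  afterTiles : ℕ → ℕ → ℕ → ℕ → List Cell → Bool
  afterTiles zero    zero    n       r       cs = tilingᵇ n r cs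
  afterTiles zero    (suc s) n       zero    cs = false
  afterTiles zero    (suc s) n       (suc r) cs = afterTiles zero s n r cs
  afterTiles (suc t) s       zero    r       cs = false
  afterTiles (suc t) s       (suc n) r       cs = afterTiles t s n r cs

mutual
  tilingᵇ-correct : ∀ n r cs → validFrom false false cs ∧ hasCounts n r cs ≡ tilingᵇ n r cs
  tilingᵇ-correct n r []             = refl
  tilingᵇ-correct n r (sq ∷ cs)      =
    trans (cong (_∧ hasCounts n r (sq ∷ cs)) (validFrom-sq cs)) (afterTiles-correct 1 1 n r cs)
  tilingᵇ-correct n r (rpost ∷ cs)   = cong (_∧ hasCounts n r (rpost ∷ cs)) (validFrom-rpost false cs)
  tilingᵇ-correct n r (lpost ∷ [])   = refl
  tilingᵇ-correct n r (lpost ∷ sq ∷ [])         = refl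
  tilingᵇ-correct n r (lpost ∷ sq ∷ sq ∷ cs)    = refl
  tilingᵇ-correct n r (lpost ∷ sq ∷ lpost ∷ cs) = refl
  tilingᵇ-correct n r (lpost ∷ sq ∷ rpost ∷ cs) =
    trans (cong₂ (λ v k → v ∧ (k ≡ᵇ n) ∧ (suc (squares cs) ≡ᵇ r)) (validFrom-fenceSq cs) (tiles-lpost (sq ∷ rpost ∷ cs)))
          (afterTiles-correct 2 1 n r cs)
  tilingᵇ-correct n r (lpost ∷ rpost ∷ [])      = refl
  tilingᵇ-correct n r (lpost ∷ rpost ∷ sq ∷ cs)    = refl
  tilingᵇ-correct n r (lpost ∷ rpost ∷ lpost ∷ cs) = refl
  tilingᵇ-correct n r (lpost ∷ rpost ∷ rpost ∷ cs) =
    cong (_∧ hasCounts n r (lpost ∷ rpost ∷ rpost ∷ cs)) (validFrom-rpost true (rpost ∷ cs))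
  tilingᵇ-correct n r (lpost ∷ lpost ∷ [])         = refl
  tilingᵇ-correct n r (lpost ∷ lpost ∷ sq ∷ cs)    = refl
  tilingᵇ-correct n r (lpost ∷ lpost ∷ lpost ∷ cs) = refl
  tilingᵇ-correct n r (lpost ∷ lpost ∷ rpost ∷ [])          = refl
  tilingᵇ-correct n r (lpost ∷ lpost ∷ rpost ∷ sq ∷ cs)     = refl
  tilingᵇ-correct n r (lpost ∷ lpost ∷ rpost ∷ lpost ∷ cs)  = refl
  tilingᵇ-correct n r (lpost ∷ lpost ∷ rpost ∷ rpost ∷ cs)  =
    trans (cong₂ (λ v k → v ∧ (k ≡ᵇ n) ∧ (squares cs ≡ᵇ r)) (validFrom-twoFences cs)
                 (trans (tiles-lpost (lpost ∷ rpost ∷ rpost ∷ cs)) (cong suc (tiles-lpost (rpost ∷ rpost ∷ cs)))))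
          (afterTiles-correct 2 0 n r cs)

  afterTiles-correct : ∀ t s n r cs →
    validFrom false false cs ∧ ((t + tiles cs ≡ᵇ n) ∧ (s + squares cs ≡ᵇ r)) ≡ afterTiles t s n r cs
  afterTiles-correct zero    zero    n       r       cs = tilingᵇ-correct n r cs
  afterTiles-correct zero    (suc s) n       zero    cs =
    trans (cong (validFrom false false cs ∧_) (∧-zeroʳ (tiles cs ≡ᵇ n))) (∧-zeroʳ _)
  afterTiles-correct zero    (suc s) n       (suc r) cs = afterTiles-correct zero s n r cs
  afterTiles-correct (suc t) s       zero    r       cs = ∧-zeroʳ _
  afterTiles-correct (suc t) s       (suc n) r       cs = afterTiles-correct t s n r cs

countBelow-fence : ∀ n r M →
  countBelow M (λ cs → tilingᵇ n r (lpost ∷ cs)) ≡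
    countBelow (M ∸ 2) (afterTiles 2 1 n r) + countBelow (M ∸ 3) (afterTiles 2 0 n r)
countBelow-fence n r zero    = refl
countBelow-fence n r (suc M) = begin
  countBelow (suc M) (after (lpost ∷ []))
    ≡⟨ countBelow-suc M (after (lpost ∷ [])) ⟩
  countBelow M (after (lpost ∷ sq ∷ [])) + (countBelow M (after (lpost ∷ lpost ∷ [])) + countBelow M (λ _ → false))
    ≡⟨ cong (countBelow M (after (lpost ∷ sq ∷ [])) +_)
            (trans (cong (countBelow M (after (lpost ∷ lpost ∷ [])) +_) (countBelow-false M (λ _ → refl))) (+-identityʳ _)) ⟩
  countBelow M (after (lpost ∷ sq ∷ [])) + countBelow M (after (lpost ∷ lpost ∷ []))
    ≡⟨ cong₂ _+_ (countBelow-rpost M (after (lpost ∷ sq ∷ [])) refl (λ _ → refl) (λ _ → refl)) (afterTwoLeftPosts M) ⟩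
  countBelow (M ∸ 1) (afterTiles 2 1 n r) + countBelow (M ∸ 2) (afterTiles 2 0 n r) ∎
  where
  after : List Cell → List Cell → Bool
  after prefix cs = tilingᵇ n r (prefix ++ cs)

  afterTwoLeftPosts : ∀ M → countBelow M (after (lpost ∷ lpost ∷ [])) ≡ countBelow (M ∸ 2) (afterTiles 2 0 n r)
  afterTwoLeftPosts zero    = refl
  afterTwoLeftPosts (suc M) =
    trans (countBelow-rpost (suc M) (after (lpost ∷ lpost ∷ [])) refl (λ _ → refl) (λ _ → refl))
          (countBelow-rpost M (after (lpost ∷ lpost ∷ rpost ∷ [])) refl (λ _ → refl) (λ _ → refl))

countBelow-tilingᵇ-suc : ∀ n r M →
  countBelow (suc M) (tilingᵇ n r) ≡
    (if tilingᵇ n r [] then 1 else 0) +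
    (countBelow M (afterTiles 1 1 n r) + (countBelow (M ∸ 2) (afterTiles 2 1 n r) + countBelow (M ∸ 3) (afterTiles 2 0 n r)))
countBelow-tilingᵇ-suc n r M = begin
  countBelow (suc M) (tilingᵇ n r)
    ≡⟨ countBelow-suc M (tilingᵇ n r) ⟩
  (if tilingᵇ n r [] then 1 else 0) + (countBelow M (afterTiles 1 1 n r) + (countBelow M (λ cs → tilingᵇ n r (lpost ∷ cs)) + countBelow M (λ _ → false)))
    ≡⟨ cong (λ k → (if tilingᵇ n r [] then 1 else 0) + (countBelow M (afterTiles 1 1 n r) + k))
            (trans (cong (countBelow M (λ cs → tilingᵇ n r (lpost ∷ cs)) +_) (countBelow-false M (λ _ → refl))) (+-identityʳ _)) ⟩
  (if tilingᵇ n r [] then 1 else 0) + (countBelow M (afterTiles 1 1 n r) + countBelow M (λ cs → tilingᵇ n r (lpost ∷ cs)))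
    ≡⟨ cong (λ k → (if tilingᵇ n r [] then 1 else 0) + (countBelow M (afterTiles 1 1 n r) + k)) (countBelow-fence n r M) ⟩
  (if tilingᵇ n r [] then 1 else 0) +
  (countBelow M (afterTiles 1 1 n r) + (countBelow (M ∸ 2) (afterTiles 2 1 n r) + countBelow (M ∸ 3) (afterTiles 2 0 n r))) ∎

D′ : ℕ → ℕ → ℕ
D′ zero          zero    = 1
D′ zero          (suc r) = 0
D′ (suc zero)    zero    = 0
D′ (suc zero)    (suc r) = D′ zero r
D′ (suc (suc n)) zero    = D′ n zero
D′ (suc (suc n)) (suc r) = D′ (suc n) r + (D′ n r + D′ n (suc r))

-- An n-tiling covers at most 2n cells, whence the bound on M.
countBelow-tilingᵇ : ∀ n r M → 2 * n < M → countBelow M (tilingᵇ n r) ≡ D′ n r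
countBelow-tilingᵇ zero r (suc M) _ = begin
  countBelow (suc M) (tilingᵇ 0 r)
    ≡⟨ countBelow-tilingᵇ-suc 0 r M ⟩
  (if (0 ≡ᵇ 0) ∧ (0 ≡ᵇ r) then 1 else 0) + (countBelow M (λ _ → false) + (countBelow (M ∸ 2) (λ _ → false) + countBelow (M ∸ 3) (λ _ → false)))
    ≡⟨ cong (λ k → (if (0 ≡ᵇ 0) ∧ (0 ≡ᵇ r) then 1 else 0) + k)
            (cong₂ _+_ (countBelow-false M (λ _ → refl)) (cong₂ _+_ (countBelow-false (M ∸ 2) (λ _ → refl)) (countBelow-false (M ∸ 3) (λ _ → refl)))) ⟩
  (if (0 ≡ᵇ 0) ∧ (0 ≡ᵇ r) then 1 else 0) + 0
    ≡⟨ emptyTiling r ⟩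
  D′ 0 r ∎
  where
  emptyTiling : ∀ r → (if (0 ≡ᵇ 0) ∧ (0 ≡ᵇ r) then 1 else 0) + 0 ≡ D′ 0 r
  emptyTiling zero    = refl
  emptyTiling (suc r) = refl
countBelow-tilingᵇ (suc zero) r (suc (suc (suc M))) (s≤s (s≤s (s≤s _))) = begin
  countBelow (3 + M) (tilingᵇ 1 r)
    ≡⟨ countBelow-tilingᵇ-suc 1 r (2 + M) ⟩
  countBelow (2 + M) (afterTiles 1 1 1 r) + (countBelow M (λ _ → false) + countBelow (M ∸ 1) (λ _ → false))
    ≡⟨ cong (countBelow (2 + M) (afterTiles 1 1 1 r) +_) (cong₂ _+_ (countBelow-false M (λ _ → refl)) (countBelow-false (M ∸ 1) (λ _ → refl))) ⟩
  countBelow (2 + M) (afterTiles 1 1 1 r) + 0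
    ≡⟨ +-identityʳ _ ⟩
  countBelow (2 + M) (afterTiles 1 1 1 r)
    ≡⟨ oneTile r ⟩
  D′ 1 r ∎
  where
  oneTile : ∀ r → countBelow (2 + M) (afterTiles 1 1 1 r) ≡ D′ 1 r
  oneTile zero    = countBelow-false (2 + M) (λ _ → refl)
  oneTile (suc r) = countBelow-tilingᵇ 0 r (2 + M) (s≤s z≤n)
countBelow-tilingᵇ (suc (suc n)) r M 2[n+2]<M
  with subst (_< M) (trans (*-suc 2 (suc n)) (cong (2 +_) (*-suc 2 n))) 2[n+2]<M
... | s≤s (s≤s (s≤s (s≤s (s≤s {n = M₀} 2n≤M₀)))) = begin
  countBelow (5 + M₀) (tilingᵇ (2 + n) r)
    ≡⟨ countBelow-tilingᵇ-suc (2 + n) r (4 + M₀) ⟩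
  countBelow (4 + M₀) (afterTiles 1 1 (2 + n) r) + (countBelow (2 + M₀) (afterTiles 2 1 (2 + n) r) + countBelow (1 + M₀) (tilingᵇ n r))
    ≡⟨ withSquares r ⟩
  D′ (2 + n) r ∎
  where
  2[n+1]<4+M₀ : 2 * suc n < 4 + M₀
  2[n+1]<4+M₀ = subst (_< 4 + M₀) (sym (*-suc 2 n)) (s≤s (s≤s (s≤s (m≤n⇒m≤1+n 2n≤M₀))))

  withSquares : ∀ r →
    countBelow (4 + M₀) (afterTiles 1 1 (2 + n) r) + (countBelow (2 + M₀) (afterTiles 2 1 (2 + n) r) + countBelow (1 + M₀) (tilingᵇ n r))
      ≡ D′ (2 + n) r
  withSquares zero    = trans (cong₂ _+_ (countBelow-false (4 + M₀) (λ _ → refl)) (cong₂ _+_ (countBelow-false (2 + M₀) (λ _ → refl)) refl))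
                              (countBelow-tilingᵇ n 0 (1 + M₀) (s≤s 2n≤M₀))
  withSquares (suc r) = cong₂ _+_ (countBelow-tilingᵇ (suc n) r (4 + M₀) 2[n+1]<4+M₀)
                                  (cong₂ _+_ (countBelow-tilingᵇ n r (2 + M₀) (s≤s (m≤n⇒m≤1+n 2n≤M₀)))
                                             (countBelow-tilingᵇ n (suc r) (1 + M₀) (s≤s 2n≤M₀)))

D≡D′ : ∀ n r → D n r ≡ D′ n r
D≡D′ n r = begin
  D n r
    ≡⟨ sum-map-upTo (λ L → tilingsOf L n r) (suc (2 * n)) ⟩
  countBelow (suc (2 * n)) (λ cs → validᵇ cs ∧ hasCounts n r cs)
    ≡⟨ countBelow-cong (suc (2 * n)) (λ cs → trans (cong (_∧ hasCounts n r cs) (validᵇ≡validFrom cs)) (tilingᵇ-correct n r cs)) ⟩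
  countBelow (suc (2 * n)) (tilingᵇ n r)
    ≡⟨ countBelow-tilingᵇ n r (suc (2 * n)) ≤-refl ⟩
  D′ n r ∎

∑D′-suc-suc : ∀ p k → ∑ (suc p) (D′ (2 + k)) ≡ ∑ p (D′ (suc k)) + ∑ p (D′ k) + ∑ (suc p) (D′ k)
∑D′-suc-suc p k = begin
  D′ k 0 + ∑ p (λ r → D′ (suc k) r + (D′ k r + D′ k (suc r)))
    ≡⟨ cong (D′ k 0 +_) (trans (∑-distrib-+ p (D′ (suc k)) _) (cong (∑ p (D′ (suc k)) +_) (∑-distrib-+ p (D′ k) (D′ k ∘ suc)))) ⟩
  D′ k 0 + (∑ p (D′ (suc k)) + (∑ p (D′ k) + ∑ p (D′ k ∘ suc)))
    ≡⟨ regroup (D′ k 0) (∑ p (D′ (suc k))) (∑ p (D′ k)) (∑ p (D′ k ∘ suc)) ⟩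
  ∑ p (D′ (suc k)) + ∑ p (D′ k) + (D′ k 0 + ∑ p (D′ k ∘ suc)) ∎
  where
  regroup : ∀ a b c d → a + (b + (c + d)) ≡ b + c + (a + d)
  regroup = solve-∀

iteratedSumJ : ℕ → ℕ → ℕ
iteratedSumJ zero    n       = J (suc n)
iteratedSumJ (suc p) zero    = 0
iteratedSumJ (suc p) (suc n) = iteratedSumJ (suc p) n + iteratedSumJ p n

∑D′+iteratedSumJ≡J : ∀ p n → ∑ p (D′ n) + iteratedSumJ p n ≡ J (suc n)
∑D′+iteratedSumJ≡J zero          n                   = refl
∑D′+iteratedSumJ≡J (suc p)       zero                = cong suc (trans (+-identityʳ _) (∑-zero p))
∑D′+iteratedSumJ≡J (suc zero)    (suc zero)          = refl
∑D′+iteratedSumJ≡J (suc (suc p)) (suc zero)          = cong suc (trans (+-identityʳ _) (∑-zero p))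
∑D′+iteratedSumJ≡J (suc p)       (suc (suc k))       = begin
  ∑ (suc p) (D′ (2 + k)) + ((iteratedSumJ (suc p) k + iteratedSumJ p k) + iteratedSumJ p (suc k))
    ≡⟨ cong (_+ ((iteratedSumJ (suc p) k + iteratedSumJ p k) + iteratedSumJ p (suc k))) (∑D′-suc-suc p k) ⟩
  (∑ p (D′ (suc k)) + ∑ p (D′ k) + ∑ (suc p) (D′ k)) + ((iteratedSumJ (suc p) k + iteratedSumJ p k) + iteratedSumJ p (suc k))
    ≡⟨ regroup (∑ p (D′ (suc k))) (∑ p (D′ k)) (∑ (suc p) (D′ k)) (iteratedSumJ (suc p) k) (iteratedSumJ p k) (iteratedSumJ p (suc k)) ⟩
  (∑ p (D′ (suc k)) + iteratedSumJ p (suc k)) + ((∑ p (D′ k) + iteratedSumJ p k) + (∑ (suc p) (D′ k) + iteratedSumJ (suc p) k))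
    ≡⟨ cong₂ _+_ (∑D′+iteratedSumJ≡J p (suc k)) (cong₂ _+_ (∑D′+iteratedSumJ≡J p k) (∑D′+iteratedSumJ≡J (suc p) k)) ⟩
  J (2 + k) + (J (suc k) + J (suc k))
    ≡⟨ cong (λ j → J (2 + k) + (J (suc k) + j)) (sym (+-identityʳ _)) ⟩
  J (3 + k) ∎
  where
  regroup : ∀ a b c x y z → (a + b + c) + ((x + y) + z) ≡ (a + z) + ((b + y) + (c + x))
  regroup = solve-∀

iteratedSumJ-vanishes : ∀ q n → n ≤ q → iteratedSumJ (suc q) n ≡ 0
iteratedSumJ-vanishes q       zero    _         = refl
iteratedSumJ-vanishes (suc q) (suc n) (s≤s n≤q) =
  cong₂ _+_ (iteratedSumJ-vanishes (suc q) n (m≤n⇒m≤1+n n≤q)) (iteratedSumJ-vanishes q n n≤q)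

binomialJ : ℕ → ℕ → ℕ
binomialJ q m = ∑ m (λ i → ((q + i) C q) * J (m ∸ i))

binomialJ-pascal : ∀ q m → binomialJ (suc q) (suc m) ≡ binomialJ (suc q) m + binomialJ q (suc m)
binomialJ-pascal q m = begin
  ∑ (suc m) (λ i → ((suc q + i) C suc q) * J (suc m ∸ i))
    ≡⟨ ∑-cong (suc m) (λ i → trans (cong (_* J (suc m ∸ i)) (sym (nCk+nC[k+1]≡[n+1]C[k+1] (q + i) q)))
                                  (*-distribʳ-+ (J (suc m ∸ i)) ((q + i) C q) ((q + i) C suc q))) ⟩
  ∑ (suc m) (λ i → ((q + i) C q) * J (suc m ∸ i) + ((q + i) C suc q) * J (suc m ∸ i))
    ≡⟨ ∑-distrib-+ (suc m) (λ i → ((q + i) C q) * J (suc m ∸ i)) (λ i → ((q + i) C suc q) * J (suc m ∸ i)) ⟩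
  binomialJ q (suc m) + (((q + 0) C suc q) * J (suc m) + ∑ m (λ i → ((q + suc i) C suc q) * J (m ∸ i)))
    ≡⟨ cong (binomialJ q (suc m) +_) (cong₂ _+_ leadingTermVanishes
                                           (∑-cong m (λ i → cong (λ k → (k C suc q) * J (m ∸ i)) (+-suc q i)))) ⟩
  binomialJ q (suc m) + binomialJ (suc q) m
    ≡⟨ +-comm (binomialJ q (suc m)) (binomialJ (suc q) m) ⟩
  binomialJ (suc q) m + binomialJ q (suc m) ∎
  where
  leadingTermVanishes : ((q + 0) C suc q) * J (suc m) ≡ 0
  leadingTermVanishes rewrite +-identityʳ q | k>n⇒nCk≡0 {q} {suc q} (n<1+n q) = refl

binomialJ-zero : ∀ m → binomialJ 0 m ≡ iteratedSumJ 1 m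
binomialJ-zero zero    = refl
binomialJ-zero (suc m) = begin
  (J (suc m) + 0) + binomialJ 0 m      ≡⟨ cong₂ _+_ (+-identityʳ (J (suc m))) (binomialJ-zero m) ⟩
  J (suc m) + iteratedSumJ 1 m         ≡⟨ +-comm (J (suc m)) (iteratedSumJ 1 m) ⟩
  iteratedSumJ 1 m + J (suc m)         ∎

binomialJ≡iteratedSumJ : ∀ q m → binomialJ q m ≡ iteratedSumJ (suc q) (q + m)
binomialJ≡iteratedSumJ q       zero    = sym (iteratedSumJ-vanishes q (q + 0) (≤-reflexive (+-identityʳ q)))
binomialJ≡iteratedSumJ zero    (suc m) = binomialJ-zero (suc m)
binomialJ≡iteratedSumJ (suc q) (suc m) = begin
  binomialJ (suc q) (suc m)                                        ≡⟨ binomialJ-pascal q m ⟩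
  binomialJ (suc q) m + binomialJ q (suc m)                        ≡⟨ cong₂ _+_ (binomialJ≡iteratedSumJ (suc q) m) (binomialJ≡iteratedSumJ q (suc m)) ⟩
  iteratedSumJ (2 + q) (suc q + m) + iteratedSumJ (suc q) (q + suc m) ≡⟨ cong (iteratedSumJ (2 + q) (suc q + m) +_) (cong (iteratedSumJ (suc q)) (+-suc q m)) ⟩
  iteratedSumJ (2 + q) (suc (suc q + m))                           ≡⟨ cong (iteratedSumJ (2 + q)) (sym (+-suc (suc q) m)) ⟩
  iteratedSumJ (2 + q) (suc q + suc m)                             ∎

sumJ≡iteratedSumJ : ∀ q n → sumJ (suc q) n ≡ iteratedSumJ (suc q) n
sumJ≡iteratedSumJ q n with q ≤? n
... | no q≰n = begin
  sumJ (suc q) n                                   ≡⟨ sum-map-upTo _ (n ∸ q) ⟩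
  ∑ (n ∸ q) (λ i → ((q + i) C q) * J (n ∸ (q + i))) ≡⟨ cong (λ k → ∑ k (λ i → ((q + i) C q) * J (n ∸ (q + i)))) (m≤n⇒m∸n≡0 n≤q) ⟩
  0                                                ≡⟨ iteratedSumJ-vanishes q n n≤q ⟨
  iteratedSumJ (suc q) n                           ∎
  where
  n≤q : n ≤ q
  n≤q = ≤-trans (n≤1+n n) (≰⇒> q≰n)
... | yes q≤n with m≤n⇒∃[o]m+o≡n q≤n
... | m , refl = begin
  sumJ (suc q) (q + m)                                         ≡⟨ sum-map-upTo _ (q + m ∸ q) ⟩
  ∑ (q + m ∸ q) (λ i → ((q + i) C q) * J (q + m ∸ (q + i)))     ≡⟨ cong (λ k → ∑ k (λ i → ((q + i) C q) * J (q + m ∸ (q + i)))) (m+n∸m≡n q m) ⟩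
  ∑ m (λ i → ((q + i) C q) * J (q + m ∸ (q + i)))               ≡⟨ ∑-cong m (λ i → cong (λ k → ((q + i) C q) * J k) ([m+n]∸[m+o]≡n∸o q m i)) ⟩
  binomialJ q m                                                ≡⟨ binomialJ≡iteratedSumJ q m ⟩
  iteratedSumJ (suc q) (q + m)                                 ∎

sumD≡∑D′ : ∀ p n → sumD p n ≡ ∑ p (D′ n)
sumD≡∑D′ p n = trans (sum-map-upTo (D n) p) (∑-cong p (D≡D′ n))

mainTheorem18 : (p n : ℕ) → p > 0 → J (suc n) ≡ sumD p n + sumJ p n
mainTheorem18 (suc q) n _ = begin
  J (suc n)                                     ≡⟨ ∑D′+iteratedSumJ≡J (suc q) n ⟨
  ∑ (suc q) (D′ n) + iteratedSumJ (suc q) n     ≡⟨ cong₂ _+_ (sumD≡∑D′ (suc q) n) (sumJ≡iteratedSumJ q n) ⟨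
  sumD (suc q) n + sumJ (suc q) n               ∎
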